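{- The quotient spaces $2^\omega/\!=^e$ and $2^\omega/\!=^f$ (each with the quotient topology induced from Cantor space) are not homeomorphic.
   Context: Fix a computable pairing bijection $\langle\cdot,\cdot\rangle:\omega^2\to\omega$. For $A\subseteq\omega$, let $\pi_1(A)=\{x:\exists y\,\langle x,y\rangle\in A\}$ and let the $x$-th column be $A^{[x]}=\{y:\langle x,y\rangle\in A\}$. Define $A=^eB$ iff $\pi_1(A)=\pi_1(B)$, and $A=^fB$ iff for all $x$, $|A^{[x]}|=|B^{[x]}|$ (cardinalities in $\omega\cup\{\omega\}$). Cantor space $2^\omega$ has basic open sets $\{h:\sigma\subset h\}$, $\sigma\in2^{<\omega}$. ($2^\omega/\!=^e$ is homeomorphic to the Scott topology on $2^\omega$, whose basic open sets are $\{h: F\subseteq h^{ -1}(1)\}$ for finite $F\subseteq\omega$.) -}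

module Defs where

open import Data.Nat using (ℕ; _<_)
open import Data.Bool using (Bool; true)
open import Data.Product using (Σ; ∃; _×_; _,_)
open import Function.Bundles using (_↔_; _⇔_)
open import Relation.Binary.PropositionalEquality using (_≡_)
open import Level using (Level; suc; _⊔_) renaming (zero to 0ℓ)

-- Cantor space: points are characteristic functions of subsets of ω.
Cantor : Set
Cantor = ℕ → Bool

record Pairing : Set where
  field
    pair    : ℕ → ℕ → ℕ
    unpair₁ : ℕ → ℕ
    unpair₂ : ℕ → ℕ
    unpair-pair₁ : ∀ x y → unpair₁ (pair x y) ≡ x
    unpair-pair₂ : ∀ x y → unpair₂ (pair x y) ≡ y
    pair-unpair  : ∀ n → pair (unpair₁ n) (unpair₂ n) ≡ n

module _ (P : Pairing) where
  open Pairing P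

  Inπ₁ : Cantor → ℕ → Set
  Inπ₁ A x = ∃ λ y → A (pair x y) ≡ true

  Column : Cantor → ℕ → Set
  Column A x = Σ ℕ λ y → A (pair x y) ≡ true

  _=ᵉ_ : Cantor → Cantor → Set
  A =ᵉ B = ∀ x → Inπ₁ A x ⇔ Inπ₁ B x

  _=ᶠ_ : Cantor → Cantor → Set
  A =ᶠ B = ∀ x → Column A x ↔ Column B x

Subset : Set₁
Subset = Cantor → Set

IsOpen : Subset → Set
IsOpen U = ∀ h → U h → ∃ λ n → ∀ g → (∀ i → i < n → g i ≡ h i) → U g

Saturated : (Cantor → Cantor → Set) → Subset → Set
Saturated E U = ∀ a b → E a b → U a → U b

-- Open sets of the quotient topology on 2^ω/E correspond exactly to
-- E-saturated open subsets of 2^ω.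
QOpen : (Cantor → Cantor → Set) → Subset → Set
QOpen E U = Saturated E U × IsOpen U

-- Maps of quotients represented by relation-respecting maps on representatives.
Respects : (E F : Cantor → Cantor → Set) → (Cantor → Cantor) → Set
Respects E F f = ∀ a b → E a b → F (f a) (f b)

QContinuous : (E F : Cantor → Cantor → Set) → (Cantor → Cantor) → Set₁
QContinuous E F f = ∀ (V : Subset) → QOpen F V → QOpen E (λ a → V (f a))

record QHomeomorphism (E F : Cantor → Cantor → Set) : Set₁ where
  field
    to        : Cantor → Cantor
    from      : Cantor → Cantor
    to-resp   : Respects E F to
    from-resp : Respects F E from
    from-to   : ∀ a → E (from (to a)) a
    to-from   : ∀ b → F (to (from b)) b
    to-cont   : QContinuous E F to
    from-cont : QContinuous F E from

-- A homeomorphism of quotients preserves the specialisation preorder ⊑ (a ⊑ b iff every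
-- open set containing a contains b) and the separation of points by open sets.  In
-- 2^ω/=ᶠ the point C₁ with one element in column 0 is the greatest point strictly below
-- the point C₂ with two elements in column 0: whatever lies below C₂ has at most two
-- elements, all of them in column 0.  In the Scott space 2^ω/=ᵉ, where ⊑ is inclusion of
-- first projections, this never happens: if π₁ A₁ is inhabited and x ∈ π₁ A₂ ∖ π₁ A₁, the
-- point {⟨x,0⟩} lies below A₂ but neither below A₁ nor above A₂.  The witnesses are
-- found constructively because a saturated open set only inspects finitely many bits.
module Submission where

open import Defs
open import Axiom.UniquenessOfIdentityProofs using (module Decidable⇒UIP)
open import Data.Bool using (Bool; true; false; _∨_; if_then_else_)
import Data.Bool.Properties as Bool
open import Data.Empty using (⊥-elim)
open import Data.Fin using (Fin; zero; suc)
open import Data.Fin.Properties using (injective⇒≤)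
open import Data.Nat using (ℕ; zero; suc; _+_; _∸_; _⊔_; _≤_; _<_; _≟_; _<?_; z≤n; s≤s)
open import Data.Nat.Properties
open import Data.Product using (Σ; ∃; _×_; _,_; proj₁; proj₂)
open import Data.Sum using (_⊎_; inj₁; inj₂; [_,_])
import Data.Sum as Sum
open import Function.Base using (_∘′_)
open import Function.Bundles using (_↔_; _↣_; Injection; Equivalence; mk↔ₛ′; mk↣; mk⇔)
open import Function.Construct.Composition using (_↔-∘_; _↣-∘_)
open import Function.Construct.Symmetry using (↔-sym; ⇔-sym)
open import Function.Properties.Inverse using (↔⇒↣)
open import Relation.Binary.Definitions using (Symmetric)
open import Relation.Binary.PropositionalEquality hiding ([_])
open import Relation.Nullary using (¬_; Dec; yes; no; does; contradiction)
open import Relation.Nullary.Decidable using (dec-true; dec-false)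
open import Relation.Nullary.Decidable.Core using (¬¬-excluded-middle)

private
  variable
    A B a b b₁ b₂ : Cantor
    k m n x y : ℕ
    E F : Cantor → Cantor → Set

¬¬-bounded-∀ : ∀ {Q : ℕ → Set} m → (∀ k → k < m → ¬ ¬ Q k) → ¬ ¬ (∀ k → k < m → Q k)
¬¬-bounded-∀ zero _ use = use (λ _ ())
¬¬-bounded-∀ {Q} (suc m) ¬¬Q use =
  ¬¬-bounded-∀ m (λ k k<m → ¬¬Q k (m<n⇒m<1+n k<m)) λ below →
  ¬¬Q m ≤-refl λ Qm →
  use λ k k<1+m → [ below k , (λ k≡m → subst Q (sym k≡m) Qm) ] (m<1+n⇒m<n∨m≡n k<1+m)

finite-bound : (h : Fin n → ℕ) → ∃ λ m → ∀ i → h i < m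
finite-bound {zero} h = 0 , λ ()
finite-bound {suc n} h with finite-bound (λ i → h (suc i))
... | m , bound = suc (h zero) ⊔ m , λ
  { zero    → m≤m⊔n _ m
  ; (suc i) → ≤-trans (bound i) (m≤n⊔m _ m) }

module _ {X : Set} where

  element↣ : X → Fin 1 ↣ X
  element↣ u = mk↣ {to = λ _ → u} injective
    where
    injective : ∀ {i j : Fin 1} → u ≡ u → i ≡ j
    injective {zero} {zero} _ = refl

  distinct₂↣ : {u v : X} → u ≢ v → Fin 2 ↣ X
  distinct₂↣ {u} {v} u≢v = mk↣ {to = f} injective
    where
    f : Fin 2 → X
    f zero = u
    f (suc zero) = v
    injective : ∀ {i j} → f i ≡ f j → i ≡ j
    injective {zero}     {zero}     _  = refl
    injective {zero}     {suc zero} eq = contradiction eq u≢v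
    injective {suc zero} {zero}     eq = contradiction (sym eq) u≢v
    injective {suc zero} {suc zero} _  = refl

  distinct₃↣ : {u v w : X} → u ≢ v → u ≢ w → v ≢ w → Fin 3 ↣ X
  distinct₃↣ {u} {v} {w} u≢v u≢w v≢w = mk↣ {to = f} injective
    where
    f : Fin 3 → X
    f zero = u
    f (suc zero) = v
    f (suc (suc zero)) = w
    injective : ∀ {i j} → f i ≡ f j → i ≡ j
    injective {zero}           {zero}           _  = refl
    injective {zero}           {suc zero}       eq = contradiction eq u≢v
    injective {zero}           {suc (suc zero)} eq = contradiction eq u≢w
    injective {suc zero}       {zero}           eq = contradiction (sym eq) u≢v
    injective {suc zero}       {suc zero}       _  = refl
    injective {suc zero}       {suc (suc zero)} eq = contradiction eq v≢w
    injective {suc (suc zero)} {zero}           eq = contradiction (sym eq) u≢w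
    injective {suc (suc zero)} {suc zero}       eq = contradiction (sym eq) v≢w
    injective {suc (suc zero)} {suc (suc zero)} _  = refl

↔Fin⇒¬↣Fin : ∀ {k} {X : Set} → k < n → X ↔ Fin k → ¬ (Fin n ↣ X)
↔Fin⇒¬↣Fin k<n X↔ f = <⇒≱ k<n (injective⇒≤ (Injection.injective (↔⇒↣ X↔ ↣-∘ f)))

Ones : (ℕ → Bool) → Set
Ones c = Σ ℕ λ y → c y ≡ true

module _ {c : ℕ → Bool} where

  ones-≡ : {u v : Ones c} → proj₁ u ≡ proj₁ v → u ≡ v
  ones-≡ {y , p} {.y , q} refl = cong (y ,_) (Decidable⇒UIP.≡-irrelevant Bool._≟_ p q)

  ones↔Fin0 : (∀ y → c y ≢ true) → Ones c ↔ Fin 0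
  ones↔Fin0 none =
    mk↔ₛ′ (λ (y , cy) → ⊥-elim (none y cy)) (λ ()) (λ ()) (λ (y , cy) → ⊥-elim (none y cy))

  ones↔Fin1 : ∀ {a} → c a ≡ true → (∀ y → c y ≡ true → y ≡ a) → Ones c ↔ Fin 1
  ones↔Fin1 {a} ca only =
    mk↔ₛ′ (λ _ → zero) (λ _ → a , ca) (λ { zero → refl }) (λ (y , cy) → ones-≡ (sym (only y cy)))

  ones↔Fin2 : ∀ {a b} → a ≢ b → c a ≡ true → c b ≡ true →
              (∀ y → c y ≡ true → y ≡ a ⊎ y ≡ b) → Ones c ↔ Fin 2
  ones↔Fin2 {a} {b} a≢b ca cb only = mk↔ₛ′ index element index-element element-index
    where
    index : Ones c → Fin 2
    index (y , _) with y ≟ a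
    ... | yes _ = zero
    ... | no _  = suc zero

    element : Fin 2 → Ones c
    element zero       = a , ca
    element (suc zero) = b , cb

    index-element : ∀ i → index (element i) ≡ i
    index-element zero with a ≟ a
    ... | yes _   = refl
    ... | no a≢a  = contradiction refl a≢a
    index-element (suc zero) with b ≟ a
    ... | yes b≡a = contradiction (sym b≡a) a≢b
    ... | no _    = refl

    element-index : ∀ u → element (index u) ≡ u
    element-index (y , cy) with y ≟ a | only y cy
    ... | yes y≡a | _        = ones-≡ (sym y≡a)
    ... | no y≢a  | inj₁ y≡a = contradiction y≡a y≢a
    ... | no _    | inj₂ y≡b = ones-≡ (sym y≡b)

  ↣Fin1-maximal⇒↔Fin1 : Fin 1 ↣ Ones c → ¬ (Fin 2 ↣ Ones c) → Ones c ↔ Fin 1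
  ↣Fin1-maximal⇒↔Fin1 f ¬two = ones↔Fin1 (proj₂ u) only
    where
    u = Injection.to f zero

    only : ∀ y → c y ≡ true → y ≡ proj₁ u
    only y cy with y ≟ proj₁ u
    ... | yes y≡u = y≡u
    ... | no y≢u  =
      contradiction (distinct₂↣ {u = u} {v = y , cy} λ eq → y≢u (sym (cong proj₁ eq))) ¬two

  ↣Fin2-maximal⇒↔Fin2 : Fin 2 ↣ Ones c → ¬ (Fin 3 ↣ Ones c) → Ones c ↔ Fin 2
  ↣Fin2-maximal⇒↔Fin2 f ¬three = ones↔Fin2 u≢v (proj₂ u) (proj₂ v) only
    where
    u = Injection.to f zero
    v = Injection.to f (suc zero)

    u≢v : proj₁ u ≢ proj₁ v
    u≢v eq with Injection.injective f (ones-≡ eq)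
    ... | ()

    only : ∀ y → c y ≡ true → y ≡ proj₁ u ⊎ y ≡ proj₁ v
    only y cy with y ≟ proj₁ u | y ≟ proj₁ v
    ... | yes y≡u | _       = inj₁ y≡u
    ... | no _    | yes y≡v = inj₂ y≡v
    ... | no y≢u  | no y≢v  = contradiction
      (distinct₃↣ {u = u} {v = v} {w = y , cy} (u≢v ∘′ cong proj₁)
                  (λ eq → y≢u (sym (cong proj₁ eq))) (λ eq → y≢v (sym (cong proj₁ eq))))
      ¬three

∅ : Cantor
∅ _ = false

opaque
  insert : ℕ → Cantor → Cantor
  insert k A j = A j ∨ does (j ≟ k)

  insert-new : insert k A k ≡ true
  insert-new {k} {A} = trans (cong (A k ∨_) (dec-true (k ≟ k) refl)) (Bool.∨-zeroʳ (A k))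

  insert-old : A y ≡ true → insert k A y ≡ true
  insert-old Ay rewrite Ay = refl

  insert-far : y ≢ k → insert k A y ≡ A y
  insert-far {y} {k} {A} y≢k =
    trans (cong (A y ∨_) (dec-false (y ≟ k) y≢k)) (Bool.∨-identityʳ (A y))

  insert-elim : insert k A y ≡ true → A y ≡ true ⊎ y ≡ k
  insert-elim {k} {A} {y} = elim (A y) (y ≟ k)
    where
    elim : ∀ b (y≟k : Dec (y ≡ k)) → b ∨ does y≟k ≡ true → b ≡ true ⊎ y ≡ k
    elim true  _         _ = inj₁ refl
    elim false (yes y≡k) _ = inj₂ y≡k

infix 4 _⊑⟨_⟩_

_⊑⟨_⟩_ : Cantor → (Cantor → Cantor → Set) → Cantor → Set₁
a ⊑⟨ E ⟩ b = ∀ U → QOpen E U → U a → U b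

record Separated (E : Cantor → Cantor → Set) (a b : Cantor) : Set₁ where
  constructor separatedBy
  field
    U      : Subset
    U-open : QOpen E U
    U∋a    : U a
    U∌b    : ¬ U b

record GreatestBelow (E : Cantor → Cantor → Set) (a b : Cantor) : Set₁ where
  constructor greatestBelow
  field
    below : a ⊑⟨ E ⟩ b
    split : ∀ d → d ⊑⟨ E ⟩ b → ¬ ¬ (d ⊑⟨ E ⟩ a ⊎ b ⊑⟨ E ⟩ d)

⊑-trans : ∀ {a b c} → a ⊑⟨ E ⟩ b → b ⊑⟨ E ⟩ c → a ⊑⟨ E ⟩ c
⊑-trans a⊑b b⊑c U U-open = b⊑c U U-open ∘′ a⊑b U U-open

≈⇒⊑ : E a b → a ⊑⟨ E ⟩ b
≈⇒⊑ a≈b U (saturated , _) = saturated _ _ a≈b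

-- Inserting a point beyond position m does not leave any basic neighbourhood [a↾m].
⊑-by-far-insertions : (∀ m → ∃ λ k → m ≤ k × E (insert k a) b) → a ⊑⟨ E ⟩ b
⊑-by-far-insertions {a = a} {b = b} far U (saturated , isOpen) Ua with isOpen a Ua
... | m , nbhd with far m
...   | k , m≤k , a′≈b =
  saturated _ b a′≈b (nbhd (insert k a) λ i i<m → insert-far (<⇒≢ (<-≤-trans i<m m≤k)))

continuous⇒monotone : ∀ {f} → QContinuous E F f → a ⊑⟨ E ⟩ b → f a ⊑⟨ F ⟩ f b
continuous⇒monotone {f = f} continuous a⊑b V V-open = a⊑b (λ c → V (f c)) (continuous V V-open)

module QHomeomorphismProperties
  (h : QHomeomorphism E F) (E-sym : Symmetric E) (F-sym : Symmetric F) where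
  open QHomeomorphism h

  to-mono : a ⊑⟨ E ⟩ b → to a ⊑⟨ F ⟩ to b
  to-mono = continuous⇒monotone to-cont

  from-mono : a ⊑⟨ F ⟩ b → from a ⊑⟨ E ⟩ from b
  from-mono = continuous⇒monotone from-cont

  from-separated : Separated F b₁ b₂ → Separated E (from b₁) (from b₂)
  from-separated {b₁ = b₁} {b₂ = b₂} (separatedBy V V-open@(saturated , _) Vb₁ ¬Vb₂) =
    separatedBy (λ a → V (to a)) (to-cont V V-open)
      (saturated _ _ (F-sym (to-from b₁)) Vb₁) λ V-b₂ → ¬Vb₂ (saturated _ _ (to-from b₂) V-b₂)

  from-greatestBelow : GreatestBelow F b₁ b₂ → GreatestBelow E (from b₁) (from b₂)
  from-greatestBelow {b₁ = b₁} {b₂ = b₂} (greatestBelow b₁⊑b₂ split) =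
    greatestBelow (from-mono b₁⊑b₂)
    λ d d⊑ k → split (to d) (⊑-trans (to-mono d⊑) (≈⇒⊑ (to-from b₂))) λ
      { (inj₁ d⊑b₁) → k (inj₁ (⊑-trans (≈⇒⊑ (E-sym (from-to d))) (from-mono d⊑b₁)))
      ; (inj₂ b₂⊑d) → k (inj₂ (⊑-trans (from-mono b₂⊑d) (≈⇒⊑ (from-to d)))) }

module Pairs (P : Pairing) where
  open Pairing P

  pair-injective : ∀ {u v} → pair x y ≡ pair u v → x ≡ u × y ≡ v
  pair-injective {x} {y} {u} {v} eq =
    trans (sym (unpair-pair₁ x y)) (trans (cong unpair₁ eq) (unpair-pair₁ u v)) ,
    trans (sym (unpair-pair₂ x y)) (trans (cong unpair₂ eq) (unpair-pair₂ u v))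

  columnBound : ℕ → ℕ
  columnBound zero = zero
  columnBound (suc m) = columnBound m ⊔ suc (unpair₂ m)

  beyond-columnBound : columnBound m ≤ y → m ≤ pair x y
  beyond-columnBound {zero} _ = z≤n
  beyond-columnBound {suc m} {y} {x} bound =
    ≤∧≢⇒< (beyond-columnBound (m⊔n≤o⇒m≤o _ _ bound))
          (λ m≡ → <⇒≢ (m⊔n≤o⇒n≤o _ _ bound) (trans (cong unpair₂ m≡) (unpair-pair₂ x y)))

module Scott (P : Pairing) where
  open Pairing P
  open Pairs P

  =ᵉ-sym : Symmetric (_=ᵉ_ P)
  =ᵉ-sym A=B x = ⇔-sym (A=B x)

  ∈⇒∈π₁ : A k ≡ true → Inπ₁ P A (unpair₁ k)
  ∈⇒∈π₁ {A} {k} Ak = unpair₂ k , subst (λ j → A j ≡ true) (sym (pair-unpair k)) Ak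

  Inπ₁-open : ∀ x → QOpen (_=ᵉ_ P) (λ B → Inπ₁ P B x)
  Inπ₁-open x =
    (λ _ _ A=B → Equivalence.to (A=B x)) ,
    λ { A (y , Axy) → suc (pair x y) , λ B agree → y , trans (agree (pair x y) ≤-refl) Axy }

  ⊑ᵉ⇒⊆ : A ⊑⟨ _=ᵉ_ P ⟩ B → ∀ x → Inπ₁ P A x → Inπ₁ P B x
  ⊑ᵉ⇒⊆ A⊑B x = A⊑B _ (Inπ₁-open x)

  π₁Prefix⊆ : ℕ → Cantor → Cantor → Set
  π₁Prefix⊆ m A B = ∀ k → k < m → A k ≡ true → Inπ₁ P B (unpair₁ k)

  -- Agrees with A below m; beyond m it is B with every column shifted up by columnBound m,
  -- so that no point of B is lost below m.
  opaque
    graft : ℕ → Cantor → Cantor → Cantor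
    graft m A B k = if does (k <? m) then A k else B (pair (unpair₁ k) (unpair₂ k ∸ columnBound m))

    graft-below : k < m → graft m A B k ≡ A k
    graft-below {k} {m} k<m rewrite dec-true (k <? m) k<m = refl

    graft-above : ¬ pair x y < m → graft m A B (pair x y) ≡ B (pair x (y ∸ columnBound m))
    graft-above {x} {y} {m} {B = B} ¬< rewrite dec-false (pair x y <? m) ¬< =
      cong₂ (λ u v → B (pair u (v ∸ columnBound m))) (unpair-pair₁ x y) (unpair-pair₂ x y)

  graft-=ᵉ : π₁Prefix⊆ m A B → _=ᵉ_ P (graft m A B) B
  graft-=ᵉ {m} {A} {B} covered x = mk⇔ forward backward
    where
    forward : Inπ₁ P (graft m A B) x → Inπ₁ P B x
    forward (y , Gxy) with pair x y <? m
    ... | yes xy<m = subst (Inπ₁ P B) (unpair-pair₁ x y)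
                       (covered _ xy<m (trans (sym (graft-below xy<m)) Gxy))
    ... | no ¬xy<m = y ∸ columnBound m , trans (sym (graft-above ¬xy<m)) Gxy

    backward : Inπ₁ P B x → Inπ₁ P (graft m A B) x
    backward (y , Bxy) = y + s , (begin
      graft m A B (pair x (y + s))   ≡⟨ graft-above (≤⇒≯ (beyond-columnBound (m≤n+m s y))) ⟩
      B (pair x (y + s ∸ s))         ≡⟨ cong (λ v → B (pair x v)) (m+n∸n≡m y s) ⟩
      B (pair x y)                   ≡⟨ Bxy ⟩
      true                           ∎)
      where
      open ≡-Reasoning
      s : ℕ
      s = columnBound m

  scott-basis : ∀ {U} → QOpen (_=ᵉ_ P) U → U A → ∃ λ m → ∀ B → π₁Prefix⊆ m A B → U B
  scott-basis {A} (saturated , isOpen) UA with isOpen A UA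
  ... | m , nbhd = m , λ B covered →
    saturated _ B (graft-=ᵉ {A = A} covered) (nbhd (graft m A B) λ _ → graft-below)

  ⊆⇒⊑ᵉ : (∀ x → Inπ₁ P A x → Inπ₁ P B x) → A ⊑⟨ _=ᵉ_ P ⟩ B
  ⊆⇒⊑ᵉ {A} {B} A⊆B U U-open UA with scott-basis U-open UA
  ... | m , basic = basic B λ _ _ Ak → A⊆B _ (∈⇒∈π₁ {A = A} Ak)

  -- U only inspects the first m bits of A, so the classical search for x is a finite one.
  separation-witness : Separated (_=ᵉ_ P) A B → ¬ ¬ (∃ λ x → Inπ₁ P A x × ¬ Inπ₁ P B x)
  separation-witness {A} {B} (separatedBy U U-open UA ¬UB) no-witness with scott-basis U-open UA
  ... | m , basic = ¬¬-bounded-∀ m covered (λ cover → ¬UB (basic B cover))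
    where
    covered : ∀ k → k < m → ¬ ¬ (A k ≡ true → Inπ₁ P B (unpair₁ k))
    covered k _ fails =
      fails λ Ak → ⊥-elim (no-witness (_ , ∈⇒∈π₁ {A = A} Ak , λ x∈B → fails λ _ → x∈B))

  no-greatest-below : ∀ {A₁ A₂} → Inπ₁ P A₁ y → Inπ₁ P A₂ x → ¬ Inπ₁ P A₁ x →
                      ¬ GreatestBelow (_=ᵉ_ P) A₁ A₂
  no-greatest-below {y} {x} {A₁} {A₂} y∈A₁ x∈A₂ x∉A₁ (greatestBelow A₁⊑A₂ split) =
    split D (⊆⇒⊑ᵉ λ z z∈D → subst (Inπ₁ P A₂) (sym (π₁D z∈D)) x∈A₂) λ
      { (inj₁ D⊑A₁) → x∉A₁ (⊑ᵉ⇒⊆ D⊑A₁ x (0 , insert-new))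
      ; (inj₂ A₂⊑D) → x∉A₁ (subst (Inπ₁ P A₁) (π₁D (⊑ᵉ⇒⊆ (⊑-trans A₁⊑A₂ A₂⊑D) y y∈A₁)) y∈A₁) }
    where
    D : Cantor
    D = insert (pair x 0) ∅

    π₁D : ∀ {z} → Inπ₁ P D z → z ≡ x
    π₁D (w , Dzw) with insert-elim Dzw
    ... | inj₁ ()
    ... | inj₂ eq = proj₁ (pair-injective eq)

module Counting (P : Pairing) where
  open Pairing P
  open Pairs P

  =ᶠ-sym : Symmetric (_=ᶠ_ P)
  =ᶠ-sym A=B x = ↔-sym (A=B x)

  AtLeast : ℕ → ℕ → Subset
  AtLeast n x B = Fin n ↣ Column P B x

  AtLeast-open : ∀ n x → QOpen (_=ᶠ_ P) (AtLeast n x)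
  AtLeast-open n x = (λ _ _ A=B f → ↔⇒↣ (A=B x) ↣-∘ f) , isOpen
    where
    isOpen : IsOpen (AtLeast n x)
    isOpen B f with finite-bound (λ i → pair x (proj₁ (Injection.to f i)))
    ... | m , bound = m , λ C agree →
      mk↣ {to = λ i → ys i , trans (agree (pair x (ys i)) (bound i)) (proj₂ (Injection.to f i))}
          (λ eq → Injection.injective f (ones-≡ (cong proj₁ eq)))
      where
      ys : Fin n → ℕ
      ys i = proj₁ (Injection.to f i)

  record ColumnSizes (A : Cantor) (s : ℕ → ℕ) : Set where
    constructor columnSizes
    field column↔Fin : ∀ x → Column P A x ↔ Fin (s x)

  open ColumnSizes

  sameSizes⇒=ᶠ : ∀ {s} → ColumnSizes A s → ColumnSizes B s → _=ᶠ_ P A B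
  sameSizes⇒=ᶠ A-sizes B-sizes x = ↔-sym (column↔Fin B-sizes x) ↔-∘ column↔Fin A-sizes x

  InColumn0 : Cantor → Set
  InColumn0 A = ∀ x y → A (pair x y) ≡ true → x ≡ 0

  insert-InColumn0 : ∀ {c} A → InColumn0 A → InColumn0 (insert (pair 0 c) A)
  insert-InColumn0 A only x y ins = [ only x y , proj₁ ∘′ pair-injective ] (insert-elim {A = A} ins)

  insert-column0 : ∀ {c} A → insert (pair 0 c) A (pair 0 y) ≡ true → A (pair 0 y) ≡ true ⊎ y ≡ c
  insert-column0 A ins = Sum.map₂ (proj₂ ∘′ pair-injective) (insert-elim {A = A} ins)

  onlyColumn0 : ℕ → ℕ → ℕ
  onlyColumn0 k zero    = k
  onlyColumn0 _ (suc _) = 0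

  column0-sizes : ∀ {k} A → InColumn0 A → Column P A 0 ↔ Fin k → ColumnSizes A (onlyColumn0 k)
  column0-sizes A only A₀↔ = columnSizes λ
    { zero    → A₀↔
    ; (suc x) → ones↔Fin0 λ y Ay → 1+n≢0 (only _ y Ay) }

  ⊑-by-column0-insertions : (∀ c → 0 ≢ c → _=ᶠ_ P (insert (pair 0 c) A) B) → A ⊑⟨ _=ᶠ_ P ⟩ B
  ⊑-by-column0-insertions insertion≈ =
    ⊑-by-far-insertions λ m → _ , beyond-columnBound (n≤1+n _) , insertion≈ _ 0≢1+n

  C₁ C₂ : Cantor
  C₁ = insert (pair 0 0) ∅
  C₂ = insert (pair 0 1) C₁

  C₁-InColumn0 : InColumn0 C₁
  C₁-InColumn0 = insert-InColumn0 ∅ λ _ _ ()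

  C₁-column0 : C₁ (pair 0 y) ≡ true → y ≡ 0
  C₁-column0 ins with insert-column0 ∅ ins
  ... | inj₁ ()
  ... | inj₂ y≡0 = y≡0

  C₁-sizes : ColumnSizes C₁ (onlyColumn0 1)
  C₁-sizes = column0-sizes C₁ C₁-InColumn0 (ones↔Fin1 insert-new λ _ → C₁-column0)

  insert-C₁-sizes : ∀ {c} → 0 ≢ c → ColumnSizes (insert (pair 0 c) C₁) (onlyColumn0 2)
  insert-C₁-sizes 0≢c = column0-sizes _ (insert-InColumn0 C₁ C₁-InColumn0)
    (ones↔Fin2 0≢c (insert-old {A = C₁} insert-new) insert-new
               λ _ ins → Sum.map₁ C₁-column0 (insert-column0 C₁ ins))

  C₂-sizes : ColumnSizes C₂ (onlyColumn0 2)
  C₂-sizes = insert-C₁-sizes 0≢1+n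

  C₁-separated-from-∅ : Separated (_=ᶠ_ P) C₁ ∅
  C₁-separated-from-∅ =
    separatedBy (AtLeast 1 0) (AtLeast-open 1 0) (↔⇒↣ (↔-sym (column↔Fin C₁-sizes 0)))
                (↔Fin⇒¬↣Fin (s≤s z≤n) (ones↔Fin0 λ _ ()))

  C₂-separated-from-C₁ : Separated (_=ᶠ_ P) C₂ C₁
  C₂-separated-from-C₁ =
    separatedBy (AtLeast 2 0) (AtLeast-open 2 0) (↔⇒↣ (↔-sym (column↔Fin C₂-sizes 0)))
                (↔Fin⇒¬↣Fin ≤-refl (column↔Fin C₁-sizes 0))

  C₁⊑C₂ : C₁ ⊑⟨ _=ᶠ_ P ⟩ C₂
  C₁⊑C₂ = ⊑-by-column0-insertions λ _ 0≢c → sameSizes⇒=ᶠ (insert-C₁-sizes 0≢c) C₂-sizes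

  below-C₂⇒InColumn0 : A ⊑⟨ _=ᶠ_ P ⟩ C₂ → InColumn0 A
  below-C₂⇒InColumn0 A⊑C₂ zero    _ _   = refl
  below-C₂⇒InColumn0 A⊑C₂ (suc x) y Axy = contradiction
    (A⊑C₂ _ (AtLeast-open 1 (suc x)) (element↣ (y , Axy)))
    (↔Fin⇒¬↣Fin (s≤s z≤n) (column↔Fin C₂-sizes (suc x)))

  empty⊑C₁ : ∀ A → InColumn0 A → ¬ AtLeast 1 0 A → A ⊑⟨ _=ᶠ_ P ⟩ C₁
  empty⊑C₁ A only ¬one = ⊑-by-column0-insertions λ c _ → sameSizes⇒=ᶠ
    (column0-sizes (insert (pair 0 c) A) (insert-InColumn0 A only)
                   (ones↔Fin1 {a = c} insert-new λ _ → new-only))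
    C₁-sizes
    where
    new-only : ∀ {c} → insert (pair 0 c) A (pair 0 y) ≡ true → y ≡ c
    new-only {y = y} ins with insert-column0 A ins
    ... | inj₁ Ay = contradiction (element↣ (y , Ay)) ¬one
    ... | inj₂ y≡c = y≡c

  below-C₂ : A ⊑⟨ _=ᶠ_ P ⟩ C₂ → ¬ ¬ (A ⊑⟨ _=ᶠ_ P ⟩ C₁ ⊎ C₂ ⊑⟨ _=ᶠ_ P ⟩ A)
  below-C₂ {A} A⊑C₂ use = ¬¬-excluded-middle λ
    { (yes two) → use (inj₂ (≈⇒⊑ (sameSizes⇒=ᶠ C₂-sizes (sizes (↣Fin2-maximal⇒↔Fin2 two ¬three)))))
    ; (no ¬two) → ¬¬-excluded-middle λ
        { (yes one) → use (inj₁ (≈⇒⊑ (sameSizes⇒=ᶠ (sizes (↣Fin1-maximal⇒↔Fin1 one ¬two))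
                                                    C₁-sizes)))
        ; (no ¬one) → use (inj₁ (empty⊑C₁ A only ¬one)) } }
    where
    only : InColumn0 A
    only = below-C₂⇒InColumn0 A⊑C₂

    sizes : ∀ {k} → Column P A 0 ↔ Fin k → ColumnSizes A (onlyColumn0 k)
    sizes = column0-sizes A only

    ¬three : ¬ AtLeast 3 0 A
    ¬three f = ↔Fin⇒¬↣Fin ≤-refl (column↔Fin C₂-sizes 0) (A⊑C₂ _ (AtLeast-open 3 0) f)

  C₁-greatestBelow-C₂ : GreatestBelow (_=ᶠ_ P) C₁ C₂
  C₁-greatestBelow-C₂ = greatestBelow C₁⊑C₂ λ _ → below-C₂

theorem8p1 : (P : Pairing) → ¬ QHomeomorphism (_=ᵉ_ P) (_=ᶠ_ P)
theorem8p1 P h =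
  separation-witness (from-separated C₁-separated-from-∅) λ { (y , y∈A₁ , _) →
  separation-witness (from-separated C₂-separated-from-C₁) λ { (x , x∈A₂ , x∉A₁) →
  no-greatest-below y∈A₁ x∈A₂ x∉A₁ (from-greatestBelow C₁-greatestBelow-C₂) } }
  where
  open Scott P
  open Counting P
  -- The points must be passed explicitly: _=ᵉ_ and _=ᶠ_ unfold before unification.
  open QHomeomorphismProperties h (λ {A} {B} → =ᵉ-sym {A} {B}) (λ {A} {B} → =ᶠ-sym {A} {B})
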